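{- Let $A$ be a quantale and $a,a_1,\dots,a_n\in A$ such that $a=\bigwedge_{i=1}^n a_i$ and $a_i\vee a_j=1$ for all $i\neq j$. Then the function $u:[a)_A\to\prod_{i=1}^n[a_i)_A$, $u(x)=(x\vee a_1,\dots,x\vee a_n)$, is a quantale isomorphism.
   Context: A quantale is a complete lattice $(A,\vee,\wedge,0,1)$ with an associative, commutative multiplication $\cdot$ with unit $1$ distributing over arbitrary joins. For $b\in A$, $[b)_A=\{x\in A:b\le x\}$ is a quantale with the lattice operations of $A$, bottom $b$, top $1$, multiplication $x\cdot_b y=(x\cdot y)\vee b$. Products of quantales carry the componentwise operations. A quantale isomorphism is a bijection preserving arbitrary joins and multiplication. -}

module Defs where

open import Level using (Level; _⊔_) renaming (suc to lsuc)
open import Data.Nat using (ℕ)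
open import Data.Fin using (Fin; zero; suc)
open import Data.Product using (Σ; ∃; _,_; proj₁; proj₂)
open import Function using (_∘_)
open import Relation.Binary.PropositionalEquality using (_≡_)
open import Relation.Binary.Structures using (IsPartialOrder)
open import Relation.Binary.Definitions using (Transitive)

record Quantale (c ℓ i : Level) : Set (lsuc (c ⊔ ℓ ⊔ i)) where
  infixr 7 _∙_
  infixr 6 _∨_
  infixr 6 _∧_
  infix 4 _≤_
  field
    Carrier        : Set c
    _≤_            : Carrier → Carrier → Set ℓ
    isPartialOrder : IsPartialOrder _≡_ _≤_
    ⋁       : {I : Set i} → (I → Carrier) → Carrier
    ⋁-upper : ∀ {I : Set i} (f : I → Carrier) (k : I) → f k ≤ ⋁ f
    ⋁-least : ∀ {I : Set i} (f : I → Carrier) (x : Carrier) → (∀ k → f k ≤ x) → ⋁ f ≤ x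
    ⋀       : {I : Set i} → (I → Carrier) → Carrier
    ⋀-lower : ∀ {I : Set i} (f : I → Carrier) (k : I) → ⋀ f ≤ f k
    ⋀-great : ∀ {I : Set i} (f : I → Carrier) (x : Carrier) → (∀ k → x ≤ f k) → x ≤ ⋀ f
    _∨_     : Carrier → Carrier → Carrier
    ∨-upperˡ : ∀ x y → x ≤ x ∨ y
    ∨-upperʳ : ∀ x y → y ≤ x ∨ y
    ∨-least  : ∀ x y z → x ≤ z → y ≤ z → x ∨ y ≤ z
    _∧_     : Carrier → Carrier → Carrier
    ∧-lowerˡ : ∀ x y → x ∧ y ≤ x
    ∧-lowerʳ : ∀ x y → x ∧ y ≤ y
    ∧-great  : ∀ x y z → z ≤ x → z ≤ y → z ≤ x ∧ y
    0#      : Carrier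
    0-least : ∀ x → 0# ≤ x
    1#      : Carrier
    1-great : ∀ x → x ≤ 1#
    _∙_      : Carrier → Carrier → Carrier
    ∙-assoc  : ∀ x y z → (x ∙ y) ∙ z ≡ x ∙ (y ∙ z)
    ∙-comm   : ∀ x y → x ∙ y ≡ y ∙ x
    ∙-identityˡ : ∀ x → 1# ∙ x ≡ x
    ∙-distrib-⋁ : ∀ x {I : Set i} (f : I → Carrier) → x ∙ ⋁ f ≡ ⋁ (λ k → x ∙ f k)

  ≤-trans : Transitive _≤_
  ≤-trans = IsPartialOrder.trans isPartialOrder

record QStruct (c ℓ i : Level) : Set (lsuc (c ⊔ ℓ ⊔ i)) where
  field
    Carrier : Set c
    _≈_     : Carrier → Carrier → Set ℓ
    ⋁       : {I : Set i} → (I → Carrier) → Carrier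
    _∙_     : Carrier → Carrier → Carrier

record IsQuantaleIso {c₁ ℓ₁ c₂ ℓ₂ i : Level}
         (S : QStruct c₁ ℓ₁ i) (T : QStruct c₂ ℓ₂ i)
         (f : QStruct.Carrier S → QStruct.Carrier T) : Set (c₁ ⊔ ℓ₁ ⊔ c₂ ⊔ ℓ₂ ⊔ lsuc i) where
  private
    module S = QStruct S
    module T = QStruct T
  field
    cong       : ∀ {x y} → x S.≈ y → f x T.≈ f y
    injective  : ∀ {x y} → f x T.≈ f y → x S.≈ y
    surjective : ∀ y → ∃ λ x → f x T.≈ y
    pres-⋁     : ∀ {I : Set i} (g : I → S.Carrier) → f (S.⋁ g) T.≈ T.⋁ (f ∘ g)
    pres-∙     : ∀ x y → f (x S.∙ y) T.≈ (f x T.∙ f y)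

module _ {c ℓ i : Level} (A : Quantale c ℓ i) where
  open Quantale A

  -- [b)_A = { x | b ≤ x }, with the lattice operations of A (the join of a
  -- family in [b) is b ∨ ⋁ f, i.e. the A-join, with b for the empty family),
  -- and multiplication x ·_b y = (x · y) ∨ b.
  Up : Carrier → QStruct (c ⊔ ℓ) c i
  Up b = record
    { Carrier = Σ Carrier (λ x → b ≤ x)
    ; _≈_     = λ x y → proj₁ x ≡ proj₁ y
    ; ⋁       = λ f → (b ∨ ⋁ (proj₁ ∘ f)) , ∨-upperˡ b _
    ; _∙_     = λ x y → ((proj₁ x ∙ proj₁ y) ∨ b) , ∨-upperʳ _ b
    }

  ⋀fin : {n : ℕ} → (Fin n → Carrier) → Carrier
  ⋀fin {ℕ.zero}  as = 1#
  ⋀fin {ℕ.suc n} as = as zero ∧ ⋀fin (as ∘ suc)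

  u : (a : Carrier) {n : ℕ} (as : Fin n → Carrier) →
      QStruct.Carrier (Up a) → (k : Fin n) → QStruct.Carrier (Up (as k))
  u a as x k = (proj₁ x ∨ as k) , ∨-upperʳ (proj₁ x) (as k)

Π : {c ℓ i : Level} (n : ℕ) → (Fin n → QStruct c ℓ i) → QStruct c ℓ i
Π n S = record
  { Carrier = (k : Fin n) → QStruct.Carrier (S k)
  ; _≈_     = λ x y → ∀ k → QStruct._≈_ (S k) (x k) (y k)
  ; ⋁       = λ f k → QStruct.⋁ (S k) (λ j → f j k)
  ; _∙_     = λ x y k → QStruct._∙_ (S k) (x k) (y k)
  }

-- Since the unit of the multiplication is the top element, x ∙ y ≤ x ∧ y,
-- and whenever c ∨ d = 1 every x splits as x = x ∙ c ∨ x ∙ d.  With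
-- c = a₁ and d = a₂ ∧ … ∧ aₙ (comaximal with a₁ by the same splitting),
-- this splitting shows that x ≤ y is determined by the components x ∨ aₖ,
-- and that y ∙ d ∨ z ∙ c ∨ (c ∧ d) glues prescribed components y ≥ c and
-- z ≥ d; induction on n gives bijectivity of u.  Joins and products are
-- preserved because x ↦ x ∨ b is a quantale morphism [a) → [b) for a ≤ b.
module Submission where

open import Defs
open import Level using (Level; Lift; lift)
open import Data.Bool using (Bool; true; false)
open import Data.Nat using (ℕ; zero; suc)
open import Data.Fin using (Fin; zero; suc)
open import Data.Fin.Properties using (suc-injective)
open import Data.Product using (Σ; _,_; _×_; proj₁; proj₂)
open import Function using (_∘_)
open import Relation.Binary.PropositionalEquality
  using (_≡_; _≢_; refl; sym; trans; cong; cong₂)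
open import Relation.Binary.Structures using (IsPartialOrder)
open import Relation.Binary.Lattice using (JoinSemilattice)
import Relation.Binary.Lattice.Properties.JoinSemilattice as JoinSemilatticeProperties
import Relation.Binary.Reasoning.PartialOrder as PartialOrderReasoning

module QuantaleProperties {c ℓ i : Level} (A : Quantale c ℓ i) where
  open Quantale A
  open IsPartialOrder isPartialOrder using (antisym)
    renaming (refl to ≤-refl; reflexive to ≤-reflexive)

  joinSemilattice : JoinSemilattice c c ℓ
  joinSemilattice = record
    { isJoinSemilattice = record
      { isPartialOrder = isPartialOrder
      ; supremum       = λ x y → ∨-upperˡ x y , ∨-upperʳ x y , ∨-least x y
      }
    }

  open JoinSemilatticeProperties joinSemilattice
    using (∨-monotonic; ∨-comm; ∨-assoc; x≤y⇒x∨y≈y)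
  open PartialOrderReasoning (JoinSemilattice.poset joinSemilattice)

  ⋁-binary : (h : Lift i Bool → Carrier) → ⋁ h ≡ h (lift true) ∨ h (lift false)
  ⋁-binary h = antisym
    (⋁-least h _ λ { (lift true) → ∨-upperˡ _ _ ; (lift false) → ∨-upperʳ _ _ })
    (∨-least _ _ _ (⋁-upper h _) (⋁-upper h _))

  ∙-distribˡ-∨ : ∀ x y z → x ∙ (y ∨ z) ≡ x ∙ y ∨ x ∙ z
  ∙-distribˡ-∨ x y z = trans (cong (x ∙_) (sym (⋁-binary pair)))
                             (trans (∙-distrib-⋁ x pair) (⋁-binary (λ b → x ∙ pair b)))
    where
    pair : Lift i Bool → Carrier
    pair (lift true)  = y
    pair (lift false) = z

  ∙-distribʳ-∨ : ∀ x y z → (y ∨ z) ∙ x ≡ y ∙ x ∨ z ∙ x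
  ∙-distribʳ-∨ x y z = begin-equality
    (y ∨ z) ∙ x    ≡⟨ ∙-comm (y ∨ z) x ⟩
    x ∙ (y ∨ z)    ≡⟨ ∙-distribˡ-∨ x y z ⟩
    x ∙ y ∨ x ∙ z  ≡⟨ cong₂ _∨_ (∙-comm x y) (∙-comm x z) ⟩
    y ∙ x ∨ z ∙ x  ∎

  ∙-identityʳ : ∀ x → x ∙ 1# ≡ x
  ∙-identityʳ x = trans (∙-comm x 1#) (∙-identityˡ x)

  ∙-monoʳ-≤ : ∀ x {y z} → y ≤ z → x ∙ y ≤ x ∙ z
  ∙-monoʳ-≤ x {y} {z} y≤z = begin
    x ∙ y          ≤⟨ ∨-upperˡ _ _ ⟩
    x ∙ y ∨ x ∙ z  ≡⟨ ∙-distribˡ-∨ x y z ⟨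
    x ∙ (y ∨ z)    ≡⟨ cong (x ∙_) (x≤y⇒x∨y≈y y≤z) ⟩
    x ∙ z          ∎

  ∙-monoˡ-≤ : ∀ x {y z} → y ≤ z → y ∙ x ≤ z ∙ x
  ∙-monoˡ-≤ x {y} {z} y≤z = begin
    y ∙ x  ≡⟨ ∙-comm y x ⟩
    x ∙ y  ≤⟨ ∙-monoʳ-≤ x y≤z ⟩
    x ∙ z  ≡⟨ ∙-comm x z ⟩
    z ∙ x  ∎

  ∙-mono-≤ : ∀ {x x′ y y′} → x ≤ x′ → y ≤ y′ → x ∙ y ≤ x′ ∙ y′
  ∙-mono-≤ x≤x′ y≤y′ = ≤-trans (∙-monoˡ-≤ _ x≤x′) (∙-monoʳ-≤ _ y≤y′)

  x∙y≤y : ∀ x y → x ∙ y ≤ y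
  x∙y≤y x y = ≤-trans (∙-monoˡ-≤ y (1-great x)) (≤-reflexive (∙-identityˡ y))

  x∙y≤x : ∀ x y → x ∙ y ≤ x
  x∙y≤x x y = ≤-trans (≤-reflexive (∙-comm x y)) (x∙y≤y y x)

  x∙y≤x∧y : ∀ x y → x ∙ y ≤ x ∧ y
  x∙y≤x∧y x y = ∧-great x y _ (x∙y≤x x y) (x∙y≤y x y)

  ∨-absorbs-≤ : ∀ x {a b} → a ≤ b → (x ∨ a) ∨ b ≡ x ∨ b
  ∨-absorbs-≤ x {a} {b} a≤b = trans (∨-assoc x a b) (cong (x ∨_) (x≤y⇒x∨y≈y a≤b))

  Comaximal : Carrier → Carrier → Set c
  Comaximal x y = x ∨ y ≡ 1#

  comaximal-sym : ∀ {x y} → Comaximal x y → Comaximal y x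
  comaximal-sym {x} {y} = trans (∨-comm y x)

  comaximal-split : ∀ {c d} → Comaximal c d → ∀ x → x ≡ x ∙ c ∨ x ∙ d
  comaximal-split {c} {d} c∨d≡1 x = begin-equality
    x              ≡⟨ ∙-identityʳ x ⟨
    x ∙ 1#         ≡⟨ cong (x ∙_) c∨d≡1 ⟨
    x ∙ (c ∨ d)    ≡⟨ ∙-distribˡ-∨ x c d ⟩
    x ∙ c ∨ x ∙ d  ∎

  comaximal-∧ : ∀ {z x y} → Comaximal z x → Comaximal z y → Comaximal z (x ∧ y)
  comaximal-∧ {z} {x} {y} z∨x≡1 z∨y≡1 = antisym (1-great _) (begin
    1#                   ≡⟨ z∨y≡1 ⟨
    z ∨ y                ≡⟨ cong (z ∨_) (comaximal-split z∨x≡1 y) ⟩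
    z ∨ (y ∙ z ∨ y ∙ x)  ≤⟨ ∨-monotonic ≤-refl
                              (∨-least _ _ _ (≤-trans (x∙y≤y y z) (∨-upperˡ _ _)) y∙x≤z∨x∧y) ⟩
    z ∨ (z ∨ x ∧ y)      ≡⟨ ∨-assoc z z _ ⟨
    (z ∨ z) ∨ x ∧ y      ≡⟨ cong (_∨ x ∧ y) (x≤y⇒x∨y≈y ≤-refl) ⟩
    z ∨ x ∧ y            ∎)
    where
    y∙x≤z∨x∧y : y ∙ x ≤ z ∨ x ∧ y
    y∙x≤z∨x∧y = ≤-trans (≤-reflexive (∙-comm y x))
                        (≤-trans (x∙y≤x∧y x y) (∨-upperʳ _ _))

  comaximal-⋀fin : ∀ {n} z (xs : Fin n → Carrier) →
                   (∀ k → Comaximal z (xs k)) → Comaximal z (⋀fin A xs)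
  comaximal-⋀fin {zero}  z xs _   = x≤y⇒x∨y≈y (1-great z)
  comaximal-⋀fin {suc n} z xs com =
    comaximal-∧ (com zero) (comaximal-⋀fin z (xs ∘ suc) (com ∘ suc))

  ⋀fin-lower : ∀ {n} (xs : Fin n → Carrier) k → ⋀fin A xs ≤ xs k
  ⋀fin-lower xs zero    = ∧-lowerˡ _ _
  ⋀fin-lower xs (suc k) = ≤-trans (∧-lowerʳ _ _) (⋀fin-lower (xs ∘ suc) k)

  PairwiseComaximal : ∀ {n} → (Fin n → Carrier) → Set c
  PairwiseComaximal xs = ∀ j k → j ≢ k → Comaximal (xs j) (xs k)

  pairwiseComaximal-tail : ∀ {n} {xs : Fin (suc n) → Carrier} →
                           PairwiseComaximal xs → PairwiseComaximal (xs ∘ suc)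
  pairwiseComaximal-tail com j k j≢k = com (suc j) (suc k) (j≢k ∘ suc-injective)

  pairwiseComaximal-head : ∀ {n} {xs : Fin (suc n) → Carrier} →
                           PairwiseComaximal xs → Comaximal (xs zero) (⋀fin A (xs ∘ suc))
  pairwiseComaximal-head {xs = xs} com =
    comaximal-⋀fin (xs zero) (xs ∘ suc) (λ k → com zero (suc k) λ ())

  ∙-≤-from-∨ : ∀ {x y c d} → x ∨ d ≤ y ∨ d → d ∙ c ≤ y → x ∙ c ≤ y
  ∙-≤-from-∨ {x} {y} {c} {d} x∨d≤y∨d d∙c≤y = begin
    x ∙ c            ≤⟨ ∙-monoˡ-≤ c (≤-trans (∨-upperˡ x d) x∨d≤y∨d) ⟩
    (y ∨ d) ∙ c      ≡⟨ ∙-distribʳ-∨ c y d ⟩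
    y ∙ c ∨ d ∙ c    ≤⟨ ∨-least _ _ _ (x∙y≤x y c) d∙c≤y ⟩
    y                ∎

  comaximal-≤ : ∀ {c d x y} → Comaximal c d → c ∧ d ≤ y →
                x ∨ c ≤ y ∨ c → x ∨ d ≤ y ∨ d → x ≤ y
  comaximal-≤ {c} {d} {x} {y} c∨d≡1 c∧d≤y x∨c≤y∨c x∨d≤y∨d = begin
    x              ≡⟨ comaximal-split c∨d≡1 x ⟩
    x ∙ c ∨ x ∙ d  ≤⟨ ∨-least _ _ _
                        (∙-≤-from-∨ x∨d≤y∨d (≤-trans (≤-reflexive (∙-comm d c)) c∙d≤y))
                        (∙-≤-from-∨ x∨c≤y∨c c∙d≤y) ⟩
    y              ∎
    where
    c∙d≤y : c ∙ d ≤ y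
    c∙d≤y = ≤-trans (x∙y≤x∧y c d) c∧d≤y

  comaximal-∨-≡ : ∀ {c d x y} → Comaximal c d → c ≤ y → x ≤ y → y ∙ d ≤ x → x ∨ c ≡ y
  comaximal-∨-≡ {c} {d} {x} {y} c∨d≡1 c≤y x≤y y∙d≤x = antisym
    (∨-least _ _ _ x≤y c≤y)
    (begin
      y              ≡⟨ comaximal-split c∨d≡1 y ⟩
      y ∙ c ∨ y ∙ d  ≤⟨ ∨-least _ _ _ (≤-trans (x∙y≤y y c) (∨-upperʳ x c))
                                      (≤-trans y∙d≤x (∨-upperˡ x c)) ⟩
      x ∨ c          ∎)

  -- The witness is the classical y ∙ d + z ∙ c, made to lie above c ∧ d.
  comaximal-glue : ∀ {c d y z} → Comaximal c d → c ≤ y → d ≤ z →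
                   Σ Carrier λ x → (c ∧ d ≤ x) × (x ∨ c ≡ y) × (x ∨ d ≡ z)
  comaximal-glue {c} {d} {y} {z} c∨d≡1 c≤y d≤z =
    x , ∨-upperʳ _ _ ,
    comaximal-∨-≡ c∨d≡1 c≤y x≤y (≤-trans (∨-upperˡ _ _) (∨-upperˡ _ _)) ,
    comaximal-∨-≡ (comaximal-sym c∨d≡1) d≤z x≤z (≤-trans (∨-upperʳ _ _) (∨-upperˡ _ _))
    where
    x = (y ∙ d ∨ z ∙ c) ∨ c ∧ d
    x≤y : x ≤ y
    x≤y = ∨-least _ _ _
      (∨-least _ _ _ (x∙y≤x y d) (≤-trans (x∙y≤y z c) c≤y))
      (≤-trans (∧-lowerˡ c d) c≤y)
    x≤z : x ≤ z
    x≤z = ∨-least _ _ _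
      (∨-least _ _ _ (≤-trans (x∙y≤y y d) d≤z) (x∙y≤x z c))
      (≤-trans (∧-lowerʳ c d) d≤z)

  ⋀fin-≤ : ∀ {n} (xs : Fin n → Carrier) → PairwiseComaximal xs → ∀ {x y} →
           ⋀fin A xs ≤ y → (∀ k → x ∨ xs k ≤ y ∨ xs k) → x ≤ y
  ⋀fin-≤ {zero}  xs com {x} ⋀≤y _ = ≤-trans (1-great x) ⋀≤y
  ⋀fin-≤ {suc n} xs com {x} {y} ⋀≤y x∨xs≤y∨xs =
    comaximal-≤ (pairwiseComaximal-head com) ⋀≤y (x∨xs≤y∨xs zero)
      (∨-least _ _ _ x≤y∨b (∨-upperʳ y b))
    where
    b = ⋀fin A (xs ∘ suc)
    x≤y∨b : x ≤ y ∨ b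
    x≤y∨b = ⋀fin-≤ (xs ∘ suc) (pairwiseComaximal-tail com) (∨-upperʳ y b)
      (λ k → ≤-trans (x∨xs≤y∨xs (suc k)) (∨-monotonic (∨-upperˡ y b) ≤-refl))

  ⋀fin-glue : ∀ {n} (xs : Fin n → Carrier) → PairwiseComaximal xs →
              (ys : Fin n → Carrier) → (∀ k → xs k ≤ ys k) →
              Σ Carrier λ x → (⋀fin A xs ≤ x) × (∀ k → x ∨ xs k ≡ ys k)
  ⋀fin-glue {zero}  xs com ys _     = 1# , 1-great _ , λ ()
  ⋀fin-glue {suc n} xs com ys xs≤ys with
    ⋀fin-glue (xs ∘ suc) (pairwiseComaximal-tail com) (ys ∘ suc) (xs≤ys ∘ suc)
  ... | x′ , b≤x′ , x′-fits with
    comaximal-glue (pairwiseComaximal-head com) (xs≤ys zero) b≤x′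
  ... | x , ⋀≤x , x∨xs₀≡ys₀ , x∨b≡x′ = x , ⋀≤x , fits
    where
    fits : ∀ k → x ∨ xs k ≡ ys k
    fits zero    = x∨xs₀≡ys₀
    fits (suc k) = begin-equality
      x ∨ xs (suc k)                        ≡⟨ ∨-absorbs-≤ x (⋀fin-lower (xs ∘ suc) k) ⟨
      (x ∨ ⋀fin A (xs ∘ suc)) ∨ xs (suc k)  ≡⟨ cong (_∨ xs (suc k)) x∨b≡x′ ⟩
      x′ ∨ xs (suc k)                       ≡⟨ x′-fits k ⟩
      ys (suc k)                            ∎

  ∨-⋁-absorbs : ∀ {I : Set i} (f : I → Carrier) b → b ∨ ⋁ (λ j → f j ∨ b) ≡ b ∨ ⋁ f
  ∨-⋁-absorbs f b = antisym
    (∨-least _ _ _ (∨-upperˡ _ _) (⋁-least _ _ λ j →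
      ∨-least _ _ _ (≤-trans (⋁-upper f j) (∨-upperʳ _ _)) (∨-upperˡ _ _)))
    (∨-monotonic ≤-refl (⋁-least f _ λ j → ≤-trans (∨-upperˡ (f j) b) (⋁-upper _ j)))

  ⋁-preserved : ∀ {I : Set i} (f : I → Carrier) {a b} → a ≤ b →
                (a ∨ ⋁ f) ∨ b ≡ b ∨ ⋁ (λ j → f j ∨ b)
  ⋁-preserved f {a} {b} a≤b = begin-equality
    (a ∨ ⋁ f) ∨ b              ≡⟨ cong (_∨ b) (∨-comm a (⋁ f)) ⟩
    (⋁ f ∨ a) ∨ b              ≡⟨ ∨-absorbs-≤ (⋁ f) a≤b ⟩
    ⋁ f ∨ b                    ≡⟨ ∨-comm (⋁ f) b ⟩
    b ∨ ⋁ f                    ≡⟨ ∨-⋁-absorbs f b ⟨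
    b ∨ ⋁ (λ j → f j ∨ b)      ∎

  ∙-∨-absorbs : ∀ x y b → (x ∨ b) ∙ (y ∨ b) ∨ b ≡ x ∙ y ∨ b
  ∙-∨-absorbs x y b = antisym
    (∨-least _ _ _ (begin
      (x ∨ b) ∙ (y ∨ b)                    ≡⟨ ∙-distribʳ-∨ (y ∨ b) x b ⟩
      x ∙ (y ∨ b) ∨ b ∙ (y ∨ b)            ≡⟨ cong (_∨ b ∙ (y ∨ b)) (∙-distribˡ-∨ x y b) ⟩
      (x ∙ y ∨ x ∙ b) ∨ b ∙ (y ∨ b)        ≤⟨ ∨-monotonic (∨-monotonic ≤-refl (x∙y≤y x b))
                                                          (x∙y≤x b (y ∨ b)) ⟩
      (x ∙ y ∨ b) ∨ b                      ≡⟨ ∨-absorbs-≤ (x ∙ y) ≤-refl ⟩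
      x ∙ y ∨ b                            ∎)
      (∨-upperʳ _ _))
    (∨-monotonic (∙-mono-≤ (∨-upperˡ x b) (∨-upperˡ y b)) ≤-refl)

  ∙-preserved : ∀ x y {a b} → a ≤ b → (x ∙ y ∨ a) ∨ b ≡ (x ∨ b) ∙ (y ∨ b) ∨ b
  ∙-preserved x y a≤b = trans (∨-absorbs-≤ (x ∙ y) a≤b) (sym (∙-∨-absorbs x y _))

proposition7p2 : {c ℓ i : Level} (A : Quantale c ℓ i) (n : ℕ) (a : Quantale.Carrier A) (as : Fin n → Quantale.Carrier A) →
    a ≡ ⋀fin A as →
    (∀ (j k : Fin n) → j ≢ k → Quantale._∨_ A (as j) (as k) ≡ Quantale.1# A) →
    IsQuantaleIso (Up A a) (Π n (λ k → Up A (as k))) (u A a as)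
proposition7p2 A n a as refl com = record
  { cong       = λ x≡y k → cong (_∨ as k) x≡y
  ; injective  = λ {(x , ⋀≤x)} {(y , ⋀≤y)} ux≡uy → antisym
      (⋀fin-≤ as com ⋀≤y (≤-reflexive ∘ ux≡uy))
      (⋀fin-≤ as com ⋀≤x (λ k → ≤-reflexive (sym (ux≡uy k))))
  ; surjective = λ ys →
      let x , ⋀≤x , fits = ⋀fin-glue as com (proj₁ ∘ ys) (proj₂ ∘ ys)
      in (x , ⋀≤x) , fits
  ; pres-⋁     = λ g k → ⋁-preserved (proj₁ ∘ g) (⋀fin-lower as k)
  ; pres-∙     = λ x y k → ∙-preserved (proj₁ x) (proj₁ y) (⋀fin-lower as k)
  }
  where
  open Quantale A
  open QuantaleProperties A
  open IsPartialOrder isPartialOrder using (antisym) renaming (reflexive to ≤-reflexive)
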